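{- Let $G$ be a finite group acting $2$-transitively on a finite set $\Omega$, and let $C \subseteq G$ be a canonical $(G,\Omega)$-Cameron-Liebler set. Then there are scalars $c_{a,b}$ ($a,b\in\Omega$) with $\mathbf{v}_C=\sum_{a,b\in\Omega} c_{a,b}\,\mathbf{v}_{a,b}$ such that either there is $a_0\in\Omega$ with $c_{a,b}=0$ for all $a\neq a_0$, or there is $b_0\in\Omega$ with $c_{a,b}=0$ for all $b\neq b_0$.
   Context: For $a,b\in\Omega$ the star is $G_{a\to b}=\{g\in G: g(a)=b\}$, and $\mathbf{v}_{a,b}$ denotes its indicator vector (a vector indexed by $G$). For $S\subseteq G$, $\mathbf{v}_S$ is its indicator vector. A $(G,\Omega)$-Cameron-Liebler (CL) set is a subset of $G$ whose indicator vector is a linear combination of the vectors $\mathbf{v}_{a,b}$, $a,b\in\Omega$. A CL set is canonical if it is a star $G_{a\to b}$ or a union of pairwise disjoint stars. -}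

module Defs where

open import Data.Nat using (ℕ; zero; suc; _≤_)
open import Data.Fin using (Fin; zero; suc)
open import Data.Fin.Properties using (_≟_)
open import Data.Bool using (Bool; true; false; if_then_else_)
open import Data.Rational using (ℚ; 0ℚ; 1ℚ; _+_; _*_)
open import Data.Product using (_×_; _,_; ∃; ∃-syntax; Σ-syntax)
open import Data.Sum using (_⊎_)
open import Relation.Nullary using (¬_; yes; no)
open import Relation.Binary.PropositionalEquality using (_≡_; _≢_)
open import Algebra.Structures using (IsGroup)

-- A finite group G, realised with carrier Fin n (every finite group is
-- isomorphic to one of this form), acting (on the left) on Ω = Fin m.
record FiniteGroupAction : Set where
  field
    n m    : ℕ
    _∙_    : Fin n → Fin n → Fin n
    ε      : Fin n
    _⁻¹    : Fin n → Fin n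
    isGroup : IsGroup _≡_ _∙_ ε _⁻¹
    act    : Fin n → Fin m → Fin m
    act-ε  : ∀ x → act ε x ≡ x
    act-∙  : ∀ g h x → act (g ∙ h) x ≡ act g (act h x)

∑ : ∀ {k} → (Fin k → ℚ) → ℚ
∑ {zero}  f = 0ℚ
∑ {suc k} f = f zero + ∑ (λ i → f (suc i))

module _ (A : FiniteGroupAction) where
  open FiniteGroupAction A

  IsTwoTransitive : Set
  IsTwoTransitive = ∀ a₁ a₂ b₁ b₂ → a₁ ≢ a₂ → b₁ ≢ b₂ →
    ∃[ g ] (act g a₁ ≡ b₁ × act g a₂ ≡ b₂)

  SubsetG : Set
  SubsetG = Fin n → Bool

  star : Fin m → Fin m → SubsetG
  star a b g with act g a ≟ b
  ... | yes _ = true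
  ... | no  _ = false

  indicator : SubsetG → Fin n → ℚ
  indicator S g = if S g then 1ℚ else 0ℚ

  v : Fin m → Fin m → Fin n → ℚ
  v a b = indicator (star a b)

  lincomb : (Fin m → Fin m → ℚ) → Fin n → ℚ
  lincomb c g = ∑ (λ a → ∑ (λ b → c a b * v a b g))

  IsCameronLiebler : SubsetG → Set
  IsCameronLiebler C = ∃[ c ] (∀ g → indicator C g ≡ lincomb c g)

  IsCanonical : SubsetG → Set
  IsCanonical C = ∃[ k ] Σ[ a ∈ (Fin k → Fin m) ] Σ[ b ∈ (Fin k → Fin m) ]
      ( 1 ≤ k
      × (∀ (i j : Fin k) → i ≢ j → ∀ g → ¬ (act g (a i) ≡ b i × act g (a j) ≡ b j))
      × (∀ g → C g ≡ true → ∃[ i ] act g (a i) ≡ b i)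
      × (∀ g (i : Fin k) → act g (a i) ≡ b i → C g ≡ true) )

-- Two disjoint stars G_{a→b} and G_{a'→b'} with a ≠ a' and b ≠ b' cannot exist in a
-- 2-transitive group, since some g maps a ↦ b and a' ↦ b' simultaneously. Hence any two
-- stars of a canonical set share their source or their target, and then all of them share
-- a common source a₀ or a common target b₀. Taking c to be the indicator of the pairs
-- (aᵢ, bᵢ) then represents C with c supported on the row a₀ or the column b₀.
module Submission where

open import Defs
open import Data.Nat using (zero; suc)
open import Data.Fin using (Fin; zero; suc)
open import Data.Fin.Properties using (_≟_; suc-injective; any?; all?; ¬∀⟶∃¬)
open import Data.Rational using (ℚ; 0ℚ; 1ℚ; _+_; _*_)
open import Data.Rational.Properties using (*-zeroˡ; *-zeroʳ; *-identityʳ; +-identityˡ; +-identityʳ)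
open import Data.Bool using (true; T; if_then_else_)
open import Data.Bool.Properties using (T-≡)
open import Data.Product using (_×_; _,_; ∃-syntax; proj₂)
open import Data.Sum using (_⊎_; inj₁; inj₂)
open import Function.Bundles using (_⇔_; mk⇔; Equivalence)
open import Data.Empty using (⊥-elim)
open import Relation.Nullary using (¬_; does; yes; no)
open import Relation.Nullary.Decidable using (_×-dec_; T?; dec-false; does-⇔)
open import Relation.Binary.Definitions using (DecidableEquality)
open import Relation.Binary.PropositionalEquality using (_≡_; _≢_; refl; sym; trans; cong; cong₂; module ≡-Reasoning)
open import Algebra.Structures using (IsGroup)

open Equivalence using (to; from)

∑-cong : ∀ {k} {f f′ : Fin k → ℚ} → (∀ i → f i ≡ f′ i) → ∑ f ≡ ∑ f′
∑-cong {zero}  f≡f′ = refl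
∑-cong {suc k} f≡f′ = cong₂ _+_ (f≡f′ zero) (∑-cong (λ i → f≡f′ (suc i)))

∑-≡0 : ∀ {k} (f : Fin k → ℚ) → (∀ i → f i ≡ 0ℚ) → ∑ f ≡ 0ℚ
∑-≡0 {zero}  f f≡0 = refl
∑-≡0 {suc k} f f≡0 = cong₂ _+_ (f≡0 zero) (∑-≡0 (λ i → f (suc i)) (λ i → f≡0 (suc i)))

∑-single : ∀ {k} (f : Fin k → ℚ) (i₀ : Fin k) → (∀ i → i ≢ i₀ → f i ≡ 0ℚ) → ∑ f ≡ f i₀
∑-single {suc k} f zero f≡0 =
  trans (cong (f zero +_) (∑-≡0 (λ i → f (suc i)) (λ i → f≡0 (suc i) (λ ()))))
        (+-identityʳ (f zero))
∑-single {suc k} f (suc i₀) f≡0 =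
  trans (cong₂ _+_ (f≡0 zero (λ ()))
                   (∑-single (λ i → f (suc i)) i₀ (λ i i≢i₀ → f≡0 (suc i) (λ e → i≢i₀ (suc-injective e)))))
        (+-identityˡ _)

∑-*-point-weight : ∀ {k} (f w : Fin k → ℚ) (i₀ : Fin k) →
  (∀ i → i ≢ i₀ → w i ≡ 0ℚ) → w i₀ ≡ 1ℚ → ∑ (λ i → f i * w i) ≡ f i₀
∑-*-point-weight f w i₀ w≡0 w≡1 = begin
  ∑ (λ i → f i * w i) ≡⟨ ∑-single _ i₀ (λ i i≢i₀ → trans (cong (f i *_) (w≡0 i i≢i₀)) (*-zeroʳ (f i))) ⟩
  f i₀ * w i₀         ≡⟨ cong (f i₀ *_) w≡1 ⟩
  f i₀ * 1ℚ           ≡⟨ *-identityʳ (f i₀) ⟩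
  f i₀                ∎
  where open ≡-Reasoning

pairwise-share⇒common : ∀ {X Y : Set} → DecidableEquality X → ∀ {k} (xs : Fin k → X) (ys : Fin k → Y) →
  (∀ i j → xs i ≡ xs j ⊎ ys i ≡ ys j) →
  ∀ i₀ → (∀ i → xs i ≡ xs i₀) ⊎ (∀ i → ys i ≡ ys i₀)
pairwise-share⇒common _≟X_ {k} xs ys share i₀ with all? (λ i → xs i ≟X xs i₀)
... | yes xs≡ = inj₁ xs≡
... | no ¬xs≡ with ¬∀⟶∃¬ k _ (λ i → xs i ≟X xs i₀) ¬xs≡
...   | j , xsj≢ = inj₂ ys≡
  where
  same-y : ∀ {i i′} → xs i ≢ xs i′ → ys i ≡ ys i′
  same-y {i} {i′} xs≢ with share i i′
  ... | inj₁ xs≡ = ⊥-elim (xs≢ xs≡)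
  ... | inj₂ ys≡ = ys≡
  ys≡ : ∀ i → ys i ≡ ys i₀
  ys≡ i with xs i ≟X xs i₀
  ... | yes xsi≡ = trans (same-y (λ xsi≡xsj → xsj≢ (trans (sym xsi≡xsj) xsi≡))) (same-y xsj≢)
  ... | no xsi≢  = same-y xsi≢

pairCoefficient : ∀ {k m} (xs ys : Fin k → Fin m) → Fin m → Fin m → ℚ
pairCoefficient xs ys a b = if does (any? (λ i → (xs i ≟ a) ×-dec (ys i ≟ b))) then 1ℚ else 0ℚ

pairCoefficient-≡0 : ∀ {k m} (xs ys : Fin k → Fin m) {a b} →
  (∀ i → ¬ (xs i ≡ a × ys i ≡ b)) → pairCoefficient xs ys a b ≡ 0ℚ
pairCoefficient-≡0 xs ys {a} {b} ¬pair
  rewrite dec-false (any? (λ i → (xs i ≟ a) ×-dec (ys i ≟ b))) (λ (i , pair) → ¬pair i pair) = refl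

pairCoefficient-off-row : ∀ {k m} (xs ys : Fin k → Fin m) {a₀} → (∀ i → xs i ≡ a₀) →
  ∀ a b → a ≢ a₀ → pairCoefficient xs ys a b ≡ 0ℚ
pairCoefficient-off-row xs ys same-source a b a≢a₀ =
  pairCoefficient-≡0 xs ys (λ i (xs≡ , _) → a≢a₀ (trans (sym xs≡) (same-source i)))

pairCoefficient-off-column : ∀ {k m} (xs ys : Fin k → Fin m) {b₀} → (∀ i → ys i ≡ b₀) →
  ∀ a b → b ≢ b₀ → pairCoefficient xs ys a b ≡ 0ℚ
pairCoefficient-off-column xs ys same-target a b b≢b₀ =
  pairCoefficient-≡0 xs ys (λ i (_ , ys≡) → b≢b₀ (trans (sym ys≡) (same-target i)))

module _ (A : FiniteGroupAction) where
  open FiniteGroupAction A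
  open IsGroup isGroup using (inverseˡ; inverseʳ)

  act-inverseʳ : ∀ g x → act g (act (g ⁻¹) x) ≡ x
  act-inverseʳ g x = trans (sym (act-∙ g (g ⁻¹) x)) (trans (cong (λ h → act h x) (inverseʳ g)) (act-ε x))

  act-inverseˡ : ∀ g x → act (g ⁻¹) (act g x) ≡ x
  act-inverseˡ g x = trans (sym (act-∙ (g ⁻¹) g x)) (trans (cong (λ h → act h x) (inverseˡ g)) (act-ε x))

  act-transpose : ∀ g {x y} → act g x ≡ y → x ≡ act (g ⁻¹) y
  act-transpose g {x} refl = sym (act-inverseˡ g x)

  v≡1 : ∀ {a b g} → act g a ≡ b → v A a b g ≡ 1ℚ
  v≡1 {a} {b} {g} ga≡b with act g a ≟ b
  ... | yes _    = refl
  ... | no ga≢b  = ⊥-elim (ga≢b ga≡b)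

  v≡0 : ∀ {a b g} → act g a ≢ b → v A a b g ≡ 0ℚ
  v≡0 {a} {b} {g} ga≢b with act g a ≟ b
  ... | yes ga≡b = ⊥-elim (ga≢b ga≡b)
  ... | no _     = refl

  ∑-*-v-target : ∀ (f : Fin m → ℚ) a g → ∑ (λ b → f b * v A a b g) ≡ f (act g a)
  ∑-*-v-target f a g = ∑-*-point-weight f _ (act g a) (λ b b≢ga → v≡0 (λ ga≡b → b≢ga (sym ga≡b))) (v≡1 refl)

  ∑-*-v-source : ∀ (f : Fin m → ℚ) b g → ∑ (λ a → f a * v A a b g) ≡ f (act (g ⁻¹) b)
  ∑-*-v-source f b g =
    ∑-*-point-weight f _ (act (g ⁻¹) b) (λ a a≢ → v≡0 (λ ga≡b → a≢ (act-transpose g ga≡b))) (v≡1 (act-inverseʳ g b))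

  lincomb-row : ∀ (c : Fin m → Fin m → ℚ) {a₀} → (∀ a b → a ≢ a₀ → c a b ≡ 0ℚ) →
    ∀ g → lincomb A c g ≡ c a₀ (act g a₀)
  lincomb-row c {a₀} row g = begin
    lincomb A c g                          ≡⟨ ∑-single _ a₀ off-row ⟩
    ∑ (λ b → c a₀ b * v A a₀ b g)          ≡⟨ ∑-*-v-target (c a₀) a₀ g ⟩
    c a₀ (act g a₀)                        ∎
    where
    open ≡-Reasoning
    off-row : ∀ a → a ≢ a₀ → ∑ (λ b → c a b * v A a b g) ≡ 0ℚ
    off-row a a≢a₀ = ∑-≡0 _ (λ b → trans (cong (_* v A a b g) (row a b a≢a₀)) (*-zeroˡ (v A a b g)))

  lincomb-column : ∀ (c : Fin m → Fin m → ℚ) {b₀} → (∀ a b → b ≢ b₀ → c a b ≡ 0ℚ) →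
    ∀ g → lincomb A c g ≡ c (act (g ⁻¹) b₀) b₀
  lincomb-column c {b₀} column g = begin
    lincomb A c g                          ≡⟨ ∑-cong (λ a → ∑-single _ b₀ (off-column a)) ⟩
    ∑ (λ a → c a b₀ * v A a b₀ g)          ≡⟨ ∑-*-v-source (λ a → c a b₀) b₀ g ⟩
    c (act (g ⁻¹) b₀) b₀                   ∎
    where
    open ≡-Reasoning
    off-column : ∀ a b → b ≢ b₀ → c a b * v A a b g ≡ 0ℚ
    off-column a b b≢b₀ = trans (cong (_* v A a b g) (column a b b≢b₀)) (*-zeroˡ (v A a b g))

  disjoint-stars⇒share : IsTwoTransitive A → ∀ {a a′ b b′} →
    (∀ g → ¬ (act g a ≡ b × act g a′ ≡ b′)) → a ≡ a′ ⊎ b ≡ b′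
  disjoint-stars⇒share two-transitive {a} {a′} {b} {b′} disjoint with a ≟ a′ | b ≟ b′
  ... | yes a≡a′ | _        = inj₁ a≡a′
  ... | no _     | yes b≡b′ = inj₂ b≡b′
  ... | no a≢a′  | no b≢b′  = ⊥-elim (disjoint _ (proj₂ (two-transitive a a′ b b′ a≢a′ b≢b′)))

  disjoint-stars⇒pairwise-share : IsTwoTransitive A → ∀ {k} (as bs : Fin k → Fin m) →
    (∀ i j → i ≢ j → ∀ g → ¬ (act g (as i) ≡ bs i × act g (as j) ≡ bs j)) →
    ∀ i j → as i ≡ as j ⊎ bs i ≡ bs j
  disjoint-stars⇒pairwise-share two-transitive as bs disjoint i j with i ≟ j
  ... | yes refl = inj₁ refl
  ... | no i≢j   = disjoint-stars⇒share two-transitive (disjoint i j i≢j)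

  module _ {k} (as bs : Fin k → Fin m) (C : SubsetG A)
           (C⊆stars : ∀ g → C g ≡ true → ∃[ i ] act g (as i) ≡ bs i)
           (stars⊆C : ∀ g i → act g (as i) ≡ bs i → C g ≡ true) where

    indicator≡pairCoefficient : ∀ g {a b} → (∀ i → act g (as i) ≡ bs i ⇔ (as i ≡ a × bs i ≡ b)) →
      indicator A C g ≡ pairCoefficient as bs a b
    indicator≡pairCoefficient g {a} {b} pointwise =
      cong (λ x → if x then 1ℚ else 0ℚ) (does-⇔ C∋g⇔pair (T? (C g)) (any? (λ i → (as i ≟ a) ×-dec (bs i ≟ b))))
      where
      C∋g⇔pair : T (C g) ⇔ (∃[ i ] (as i ≡ a × bs i ≡ b))
      C∋g⇔pair = mk⇔
        (λ g∈C → let (i , hit) = C⊆stars g (to T-≡ g∈C) in i , to (pointwise i) hit)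
        (λ (i , pair) → from T-≡ (stars⊆C g i (from (pointwise i) pair)))

    indicator-common-source : ∀ {a₀} → (∀ i → as i ≡ a₀) →
      ∀ g → indicator A C g ≡ pairCoefficient as bs a₀ (act g a₀)
    indicator-common-source same-source g = indicator≡pairCoefficient g λ i → mk⇔
      (λ hit → same-source i , trans (sym hit) (cong (act g) (same-source i)))
      (λ (as≡ , bs≡) → trans (cong (act g) as≡) (sym bs≡))

    indicator-common-target : ∀ {b₀} → (∀ i → bs i ≡ b₀) →
      ∀ g → indicator A C g ≡ pairCoefficient as bs (act (g ⁻¹) b₀) b₀
    indicator-common-target {b₀} same-target g = indicator≡pairCoefficient g λ i → mk⇔
      (λ hit → act-transpose g (trans hit (same-target i)) , same-target i)
      (λ (as≡ , bs≡) → trans (cong (act g) as≡) (trans (act-inverseʳ g b₀) (sym bs≡)))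

proposition1p3 : (A : FiniteGroupAction) → IsTwoTransitive A →
    (C : SubsetG A) → IsCameronLiebler A C → IsCanonical A C →
    ∃[ c ] ( (∀ g → indicator A C g ≡ lincomb A c g)
           × ( (∃[ a₀ ] ∀ a b → a ≢ a₀ → c a b ≡ 0ℚ)
             ⊎ (∃[ b₀ ] ∀ a b → b ≢ b₀ → c a b ≡ 0ℚ) ) )
proposition1p3 A two-transitive C _ (suc k , as , bs , _ , disjoint , C⊆stars , stars⊆C)
  with pairwise-share⇒common _≟_ as bs (disjoint-stars⇒pairwise-share A two-transitive as bs disjoint) zero
... | inj₁ same-source =
  pairCoefficient as bs ,
  (λ g → trans (indicator-common-source A as bs C C⊆stars stars⊆C same-source g)
               (sym (lincomb-row A _ row g))) ,
  inj₁ (as zero , row)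
  where
  row : ∀ a b → a ≢ as zero → pairCoefficient as bs a b ≡ 0ℚ
  row = pairCoefficient-off-row as bs same-source
... | inj₂ same-target =
  pairCoefficient as bs ,
  (λ g → trans (indicator-common-target A as bs C C⊆stars stars⊆C same-target g)
               (sym (lincomb-column A _ column g))) ,
  inj₂ (bs zero , column)
  where
  column : ∀ a b → b ≢ bs zero → pairCoefficient as bs a b ≡ 0ℚ
  column = pairCoefficient-off-column as bs same-target
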